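{- Let $K$ be a complete discretely valued field with ring of integers $\mathfrak{o}_K$, uniformizer $\pi$ and valuation $v$, and let $m$ be a positive integer. Let $A$ be an $n \times n$ matrix over $\mathfrak{o}_K$ with reduction $\overline{A}$ over $\mathfrak{o}_K/\pi^m\mathfrak{o}_K$. Run the following procedure on $\overline{A}$: (1) if $\overline{A}$ has no nonzero entries (possibly because it is empty), return its number of columns and stop; (2) choose a nonzero entry $\overline{A}_{ij}$ of minimum valuation; (3) for each row index $k \neq i$, subtract $c$ times row $i$ from row $k$, where $c \in \mathfrak{o}_K/\pi^m\mathfrak{o}_K$ satisfies $c\overline{A}_{ij} = \overline{A}_{kj}$; (4) for each column index $\ell \neq j$, subtract $c$ times column $j$ from column $\ell$, where $c\overline{A}_{ij} = \overline{A}_{i\ell}$; (5) delete row $i$ and column $j$ and return to (1). Suppose the procedure returns $0$ (so it performs exactly $n$ iterations of steps (2)--(5)). For $h = 1, \dots, n$, let $i,j$ be the indices (in the current matrix) chosen in step (2) of the $h$-th iteration, put $\overline{a_h} = \overline{A}_{ij}$ and $e_h = (-1)^{i+j}$, and choose lifts $a_h \in \mathfrak{o}_K$ of $\overline{a_h}$. Then \[ v\bigl(\det(A) - a_1e_1\cdots a_ne_n\bigr) \geq \min_i \{m - v(a_i)\} + \sum_{i=1}^n v(a_i). \]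
   Context: The valuation of a nonzero element of $\mathfrak{o}_K/\pi^m\mathfrak{o}_K$ is the valuation of any lift to $\mathfrak{o}_K$. -}

module Defs where

open import Level using (Level; _⊔_) renaming (suc to lsuc)
open import Algebra.Bundles using (CommutativeRing)
open import Data.Nat as ℕ using (ℕ; zero; suc; _≤_; _∸_)
open import Data.Fin as Fin using (Fin; zero; suc; punchIn; toℕ)
open import Data.Vec using (Vec; []; _∷_; lookup)
open import Data.Product using (Σ; ∃; _×_; _,_)
open import Data.Bool using (if_then_else_)
open import Relation.Nullary using (¬_; does)
open import Relation.Binary.PropositionalEquality using (_≡_; _≢_)

data ℕ∞ : Set where
  fin : ℕ → ℕ∞
  ∞   : ℕ∞

data _≤∞_ : ℕ∞ → ℕ∞ → Set where
  fin≤fin : ∀ {a b} → a ≤ b → fin a ≤∞ fin b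
  _≤∞-top : ∀ x → x ≤∞ ∞

_<∞_ : ℕ∞ → ℕ∞ → Set
x <∞ y = ¬ (y ≤∞ x)

_+∞_ : ℕ∞ → ℕ∞ → ℕ∞
fin a +∞ fin b = fin (a ℕ.+ b)
_     +∞ _     = ∞

min∞ : ℕ∞ → ℕ∞ → ℕ∞
min∞ (fin a) (fin b) = fin (ℕ._⊓_ a b)
min∞ (fin a) ∞       = fin a
min∞ ∞       y       = y

-- m - x (only ever applied to finite x < m in the statement)
_∸∞_ : ℕ → ℕ∞ → ℕ∞
m ∸∞ fin a = fin (m ∸ a)
m ∸∞ ∞     = fin 0

-- The ring of integers 𝔬_K of a complete discretely valued field K,
-- with its normalised valuation v (v(π) = 1, v(0) = ∞) and uniformizer π.

record CompleteDVR (c ℓ : Level) : Set (lsuc (c ⊔ ℓ)) where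
  field
    commRing : CommutativeRing c ℓ
  open CommutativeRing commRing public
  field
    v        : Carrier → ℕ∞
    v-cong   : ∀ {x y} → x ≈ y → v x ≡ v y
    v-∞⇒0    : ∀ {x} → v x ≡ ∞ → x ≈ 0#
    v-0      : v 0# ≡ ∞
    v-mul    : ∀ x y → v (x * y) ≡ v x +∞ v y
    v-add    : ∀ x y → min∞ (v x) (v y) ≤∞ v (x + y)
    π        : Carrier
    v-π      : v π ≡ fin 1
    -- 𝔬_K is the whole valuation ring: v x ≤ v y ⇒ x ∣ y
    v-div    : ∀ x y → v x ≤∞ v y → ∃ λ z → y ≈ x * z
    complete : (s : ℕ → Carrier) →
               (∀ N → ∃ λ M → ∀ p q → M ≤ p → M ≤ q → fin N ≤∞ v (s p - s q)) →
               ∃ λ L → ∀ N → ∃ λ M → ∀ p → M ≤ p → fin N ≤∞ v (s p - L)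

-- Matrices, determinant, and the reduction procedure over 𝔬_K / π^m 𝔬_K.
-- Elements of 𝔬_K/π^m are represented by lifts in 𝔬_K, with x ≡ y iff
-- π^m ∣ (x - y), i.e. v(x - y) ≥ m.

module Procedure {c ℓ} (D : CompleteDVR c ℓ) (m : ℕ) where
  open CompleteDVR D using (Carrier; _+_; _*_; -_; _-_; 0#; 1#; v)

  Matrix : ℕ → ℕ → Set c
  Matrix r s = Fin r → Fin s → Carrier

  sgn : ℕ → Carrier
  sgn zero    = 1#
  sgn (suc k) = - sgn k

  sumFin : ∀ {n} → (Fin n → Carrier) → Carrier
  sumFin {zero}  f = 0#
  sumFin {suc n} f = f zero + sumFin (λ i → f (suc i))

  prodVec : ∀ {n} → Vec Carrier n → Carrier
  prodVec []       = 1#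
  prodVec (x ∷ xs) = x * prodVec xs

  minor : ∀ {r s} → Matrix (suc r) (suc s) → Fin (suc r) → Fin (suc s) → Matrix r s
  minor M i j k l = M (punchIn i k) (punchIn j l)

  det : ∀ {n} → Matrix n n → Carrier
  det {zero}  M = 1#
  det {suc n} M = sumFin (λ j → sgn (toℕ j) * (M zero j * det (minor M zero j)))

  _≡m_ : Carrier → Carrier → Set
  x ≡m y = fin m ≤∞ v (x - y)

  IsZeroMod : Carrier → Set
  IsZeroMod x = fin m ≤∞ v x

  rowOps : ∀ {r s} → Matrix r s → Fin r → (Fin r → Carrier) → Matrix r s
  rowOps M i c k l = if does (k Fin.≟ i) then M k l else (M k l - c k * M i l)

  colOps : ∀ {r s} → Matrix r s → Fin s → (Fin s → Carrier) → Matrix r s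
  colOps M j d k l = if does (l Fin.≟ j) then M k l else (M k l - d l * M k j)

  -- Run M k as es res : one execution of the (nondeterministic) procedure on
  -- M performs k iterations, the h-th choosing the entry ā_h (entry of the
  -- h-th element of as) at 0-based current position (i,j) with
  -- i + j = h-th element of es (so e_h = (-1)^(i+j)), and returns res.
  data Run : ∀ {r s} → Matrix r s → (k : ℕ) → Vec Carrier k → Vec ℕ k → ℕ → Set (c ⊔ ℓ) where
    stop : ∀ {r s} {M : Matrix r s} →
           (∀ i j → IsZeroMod (M i j)) →
           Run M 0 [] [] s
    step : ∀ {r s k as es res} {M : Matrix (suc r) (suc s)}
           (i : Fin (suc r)) (j : Fin (suc s)) →
           ¬ IsZeroMod (M i j) →
           (∀ k l → ¬ IsZeroMod (M k l) → v (M i j) ≤∞ v (M k l)) →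
           (c : Fin (suc r) → Carrier) →
           (∀ k → k ≢ i → (c k * M i j) ≡m M k j) →
           (d : Fin (suc s) → Carrier) →
           (∀ l → l ≢ j → (d l * rowOps M i c i j) ≡m rowOps M i c i l) →
           Run (minor (colOps (rowOps M i c) j d) i j) k as es res →
           Run M (suc k) (M i j ∷ as) (toℕ i ℕ.+ toℕ j ∷ es) res

  sum∞ : ∀ {n} → (Fin n → ℕ∞) → ℕ∞
  sum∞ {zero}  f = fin 0
  sum∞ {suc n} f = f zero +∞ sum∞ (λ i → f (suc i))

  min∞Fin : ∀ {n} → (Fin n → ℕ∞) → ℕ∞
  min∞Fin {zero}  f = ∞
  min∞Fin {suc n} f = min∞ (f zero) (min∞Fin (λ i → f (suc i)))

  signedProd : ∀ {n} → Vec Carrier n → Vec ℕ n → Carrier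
  signedProd []       []       = 1#
  signedProd (a ∷ as) (e ∷ es) = (a * sgn e) * signedProd as es

-- Call X a lift of N when X ≡ N entrywise mod π^m.  By induction along the run we bound
-- v(det X − a₁e₁⋯aₙeₙ) for every lift X of the current matrix, not only for A.  One iteration
-- replaces X by B = colOps (rowOps X), which has the same determinant and is a lift of a matrix
-- whose pivot row and pivot column vanish mod π^m away from the pivot β ≡ a₁.  With M the pivot
-- minor of B and Π = a₂e₂⋯aₙeₙ,
--   det B − a₁e₁Π = (det B − e₁β det M) + e₁β (det M − Π) + e₁(β − a₁) Π.
-- The last two terms are bounded by the induction hypothesis for M and by v(β − a₁) ≥ m.  Expanding
-- along the pivot row and then along the pivot column, the first term is a sum of products of two
-- entries of valuation ≥ m with minors of M.  Those minors are controlled by the induction hypothesis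
-- as well: adding π^m to one entry of M gives another lift, and changes det M by ±π^m times a minor.

module Submission where

open import Defs
open import Algebra.Bundles using (AbelianGroup)
open import Data.Nat as ℕ using (ℕ; zero; suc; _≤_; _<_)
import Data.Nat.Properties as ℕ
open import Data.Fin as Fin using (Fin; zero; suc; punchIn; punchOut; toℕ)
import Data.Fin.Properties as Fin
open import Data.Vec using (Vec; []; _∷_; lookup)
open import Data.Vec.Functional using (Vector; updateAt)
open import Data.Vec.Functional.Properties using (updateAt-updates; updateAt-minimal; updateAt-updateAt)
open import Data.Product using (Σ; _×_; _,_; proj₁; proj₂)
open import Data.Empty using (⊥-elim)
open import Function using (_∘_; const; case_of_)
open import Relation.Nullary using (¬_; yes; no)
open import Relation.Binary.PropositionalEquality as ≡ using (_≡_; _≢_)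

≤∞-refl : ∀ {x} → x ≤∞ x
≤∞-refl {fin a} = fin≤fin ℕ.≤-refl
≤∞-refl {∞}     = ∞ ≤∞-top

≤∞-reflexive : ∀ {x y} → x ≡ y → x ≤∞ y
≤∞-reflexive ≡.refl = ≤∞-refl

≤∞-trans : ∀ {x y z} → x ≤∞ y → y ≤∞ z → x ≤∞ z
≤∞-trans (fin≤fin p) (fin≤fin q) = fin≤fin (ℕ.≤-trans p q)
≤∞-trans {x} _       (_ ≤∞-top)  = x ≤∞-top

0≤∞ : ∀ x → fin 0 ≤∞ x
0≤∞ (fin a) = fin≤fin ℕ.z≤n
0≤∞ ∞       = fin 0 ≤∞-top

min∞-≤ˡ : ∀ x y → min∞ x y ≤∞ x
min∞-≤ˡ (fin a) (fin b) = fin≤fin (ℕ.m⊓n≤m a b)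
min∞-≤ˡ (fin a) ∞       = ≤∞-refl
min∞-≤ˡ ∞       y       = y ≤∞-top

min∞-≤ʳ : ∀ x y → min∞ x y ≤∞ y
min∞-≤ʳ (fin a) (fin b) = fin≤fin (ℕ.m⊓n≤n a b)
min∞-≤ʳ (fin a) ∞       = fin a ≤∞-top
min∞-≤ʳ ∞       y       = ≤∞-refl

min∞-glb : ∀ {x y z} → z ≤∞ x → z ≤∞ y → z ≤∞ min∞ x y
min∞-glb (fin≤fin p) (fin≤fin q) = fin≤fin (ℕ.⊓-glb p q)
min∞-glb (fin≤fin p) (_ ≤∞-top)  = fin≤fin p
min∞-glb (_ ≤∞-top)  q           = q

+∞-mono-≤∞ : ∀ {x x′ y y′} → x ≤∞ x′ → y ≤∞ y′ → (x +∞ y) ≤∞ (x′ +∞ y′)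
+∞-mono-≤∞ (fin≤fin p) (fin≤fin q) = fin≤fin (ℕ.+-mono-≤ p q)
+∞-mono-≤∞ (fin≤fin _) (_ ≤∞-top)  = _ ≤∞-top
+∞-mono-≤∞ (_ ≤∞-top)  _           = _ ≤∞-top

+∞-identityˡ : ∀ x → (fin 0 +∞ x) ≡ x
+∞-identityˡ (fin a) = ≡.refl
+∞-identityˡ ∞       = ≡.refl

+∞-comm : ∀ x y → x +∞ y ≡ y +∞ x
+∞-comm (fin a) (fin b) = ≡.cong fin (ℕ.+-comm a b)
+∞-comm (fin a) ∞       = ≡.refl
+∞-comm ∞       (fin b) = ≡.refl
+∞-comm ∞       ∞       = ≡.refl

+∞-assoc : ∀ x y z → (x +∞ y) +∞ z ≡ x +∞ (y +∞ z)
+∞-assoc (fin a) (fin b) (fin c) = ≡.cong fin (ℕ.+-assoc a b c)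
+∞-assoc (fin a) (fin b) ∞       = ≡.refl
+∞-assoc (fin a) ∞       z       = ≡.refl
+∞-assoc ∞       y       z       = ≡.refl

fin≰∞⇒fin< : ∀ {m} x → ¬ (fin m ≤∞ x) → Σ ℕ λ k → x ≡ fin k × k < m
fin≰∞⇒fin< (fin k) k≱m = k , ≡.refl , ℕ.≰⇒> (λ m≤k → k≱m (fin≤fin m≤k))
fin≰∞⇒fin< {m} ∞ ∞≱m = ⊥-elim (∞≱m (fin m ≤∞-top))

module AbelianGroupLemmas {a ℓ} (G : AbelianGroup a ℓ) where
  open AbelianGroup G
  open import Relation.Binary.Reasoning.Setoid setoid
  open import Algebra.Properties.AbelianGroup G using (⁻¹-anti-homo‿-; ε⁻¹≈ε)
  open import Algebra.Solver.CommutativeMonoid commutativeMonoid using (solve; _⊜_; _⊕_)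

  [x∙y]-x≈y : ∀ x y → (x ∙ y) - x ≈ y
  [x∙y]-x≈y x y = begin
    (x ∙ y) ∙ x ⁻¹   ≈⟨ solve 3 (λ x y x′ → (x ⊕ y) ⊕ x′ ⊜ y ⊕ (x ⊕ x′)) refl x y (x ⁻¹) ⟩
    y ∙ (x ∙ x ⁻¹)   ≈⟨ ∙-congˡ (inverseʳ x) ⟩
    y ∙ ε            ≈⟨ identityʳ y ⟩
    y                ∎

  y∙[x-y]≈x : ∀ x y → y ∙ (x - y) ≈ x
  y∙[x-y]≈x x y = begin
    y ∙ (x ∙ y ⁻¹)   ≈⟨ solve 3 (λ x y y′ → y ⊕ (x ⊕ y′) ⊜ x ⊕ (y ⊕ y′)) refl x y (y ⁻¹) ⟩
    x ∙ (y ∙ y ⁻¹)   ≈⟨ ∙-congˡ (inverseʳ y) ⟩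
    x ∙ ε            ≈⟨ identityʳ x ⟩
    x                ∎

  [x-y]∙[y-z]≈x-z : ∀ x y z → (x - y) ∙ (y - z) ≈ x - z
  [x-y]∙[y-z]≈x-z x y z = begin
    (x ∙ y ⁻¹) ∙ (y ∙ z ⁻¹)   ≈⟨ solve 4 (λ x y′ y z′ → (x ⊕ y′) ⊕ (y ⊕ z′) ⊜ (x ⊕ z′) ⊕ (y ⊕ y′))
                                         refl x (y ⁻¹) y (z ⁻¹) ⟩
    (x ∙ z ⁻¹) ∙ (y ∙ y ⁻¹)   ≈⟨ ∙-congˡ (inverseʳ y) ⟩
    (x ∙ z ⁻¹) ∙ ε            ≈⟨ identityʳ (x - z) ⟩
    x ∙ z ⁻¹                  ∎

  [x-y]-[u-w]≈[x-u]-[y-w] : ∀ x y u w → (x - y) - (u - w) ≈ (x - u) - (y - w)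
  [x-y]-[u-w]≈[x-u]-[y-w] x y u w = begin
    (x ∙ y ⁻¹) ∙ (u - w) ⁻¹    ≈⟨ ∙-congˡ (⁻¹-anti-homo‿- u w) ⟩
    (x ∙ y ⁻¹) ∙ (w ∙ u ⁻¹)    ≈⟨ solve 4 (λ x y′ w u′ → (x ⊕ y′) ⊕ (w ⊕ u′) ⊜ (x ⊕ u′) ⊕ (w ⊕ y′))
                                          refl x (y ⁻¹) w (u ⁻¹) ⟩
    (x ∙ u ⁻¹) ∙ (w ∙ y ⁻¹)    ≈⟨ ∙-congˡ (⁻¹-anti-homo‿- y w) ⟨
    (x ∙ u ⁻¹) ∙ (y - w) ⁻¹    ∎

  [x-z]-[y-z]≈x-y : ∀ x y z → (x - z) - (y - z) ≈ x - y
  [x-z]-[y-z]≈x-y x y z = begin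
    (x - z) - (y - z)   ≈⟨ [x-y]-[u-w]≈[x-u]-[y-w] x z y z ⟩
    (x - y) - (z - z)   ≈⟨ ∙-congˡ (⁻¹-cong (inverseʳ z)) ⟩
    (x - y) ∙ ε ⁻¹      ≈⟨ ∙-congˡ ε⁻¹≈ε ⟩
    (x - y) ∙ ε         ≈⟨ identityʳ (x - y) ⟩
    x - y               ∎

module Valuation {c ℓ} (D : CompleteDVR c ℓ) where
  open CompleteDVR D hiding (zero)
  open import Algebra.Properties.Ring ring using (-1*x≈-x)
  open import Algebra.Properties.AbelianGroup +-abelianGroup using (⁻¹-involutive)
  open import Algebra.Properties.Semiring.Exp semiring using (_^_)

  v-resp-≈ : ∀ {b x y} → x ≈ y → b ≤∞ v x → b ≤∞ v y
  v-resp-≈ x≈y b≤vx = ≤∞-trans b≤vx (≤∞-reflexive (v-cong x≈y))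

  v-0#-≥ : ∀ b → b ≤∞ v 0#
  v-0#-≥ b = ≤∞-trans (b ≤∞-top) (≤∞-reflexive (≡.sym v-0))

  v-*-mono : ∀ {a b x y} → a ≤∞ v x → b ≤∞ v y → (a +∞ b) ≤∞ v (x * y)
  v-*-mono {x = x} {y} a≤vx b≤vy = ≤∞-trans (+∞-mono-≤∞ a≤vx b≤vy) (≤∞-reflexive (≡.sym (v-mul x y)))

  v-*ʳ : ∀ x y → v y ≤∞ v (x * y)
  v-*ʳ x y = ≤∞-trans (≤∞-reflexive (≡.sym (+∞-identityˡ (v y)))) (v-*-mono (0≤∞ (v x)) ≤∞-refl)

  v-+-≥ : ∀ {b x y} → b ≤∞ v x → b ≤∞ v y → b ≤∞ v (x + y)
  v-+-≥ {x = x} {y} b≤vx b≤vy = ≤∞-trans (min∞-glb b≤vx b≤vy) (v-add x y)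

  v-1# : v 1# ≡ fin 0
  v-1# = fin1≡1+x⇒x≡0 (v 1#) (≡.trans (≡.sym v-π) (≡.trans (v-cong (sym (*-identityʳ π)))
                        (≡.trans (v-mul π 1#) (≡.cong (_+∞ v 1#) v-π))))
    where
    fin1≡1+x⇒x≡0 : ∀ x → fin 1 ≡ (fin 1 +∞ x) → x ≡ fin 0
    fin1≡1+x⇒x≡0 (fin zero)    _  = ≡.refl
    fin1≡1+x⇒x≡0 (fin (suc _)) ()
    fin1≡1+x⇒x≡0 ∞             ()

  v-[-1] : v (- 1#) ≡ fin 0
  v-[-1] = x+x≡0⇒x≡0 (v (- 1#)) (≡.trans (≡.sym (v-mul (- 1#) (- 1#)))
                        (≡.trans (v-cong (trans (-1*x≈-x (- 1#)) (⁻¹-involutive 1#))) v-1#))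
    where
    x+x≡0⇒x≡0 : ∀ x → (x +∞ x) ≡ fin 0 → x ≡ fin 0
    x+x≡0⇒x≡0 (fin zero)    _  = ≡.refl
    x+x≡0⇒x≡0 (fin (suc _)) ()
    x+x≡0⇒x≡0 ∞             ()

  v-neg : ∀ x → v (- x) ≡ v x
  v-neg x = ≡.trans (v-cong (sym (-1*x≈-x x))) (≡.trans (v-mul (- 1#) x) (≡.trans (≡.cong (_+∞ v x) v-[-1]) (+∞-identityˡ (v x))))

  v-−-≥ : ∀ {b x y} → b ≤∞ v x → b ≤∞ v y → b ≤∞ v (x - y)
  v-−-≥ {y = y} b≤vx b≤vy = v-+-≥ b≤vx (≤∞-trans b≤vy (≤∞-reflexive (≡.sym (v-neg y))))

  v-π^ : ∀ k → v (π ^ k) ≡ fin k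
  v-π^ zero    = v-1#
  v-π^ (suc k) = ≡.trans (v-mul π (π ^ k)) (≡.cong₂ _+∞_ v-π (v-π^ k))

  v-*ˡ : ∀ x y → v x ≤∞ v (x * y)
  v-*ˡ x y = v-resp-≈ (*-comm y x) (v-*ʳ y x)

_[_]≔_ : ∀ {a} {A : Set a} {n} → Vector A n → Fin n → A → Vector A n
xs [ i ]≔ x = updateAt xs i (const x)

[]≔-updates : ∀ {a} {A : Set a} {n} (xs : Vector A n) i {x} → (xs [ i ]≔ x) i ≡ x
[]≔-updates xs i = updateAt-updates i xs

[]≔-minimal : ∀ {a} {A : Set a} {n} (xs : Vector A n) {i k} {x} → k ≢ i → (xs [ i ]≔ x) k ≡ xs k
[]≔-minimal xs {i} {k} = updateAt-minimal k i xs

punchIn-punchOut-comm : ∀ {n} {i j : Fin (suc (suc n))} (i≢j : i ≢ j) (j≢i : j ≢ i) (k : Fin n) →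
  punchIn i (punchIn (punchOut i≢j) k) ≡ punchIn j (punchIn (punchOut j≢i) k)
punchIn-punchOut-comm {i = zero}  {zero}  i≢j _ k = ⊥-elim (i≢j ≡.refl)
punchIn-punchOut-comm {suc n} {zero}  {suc j} _ _ k = ≡.refl
punchIn-punchOut-comm {suc n} {suc i} {zero}  _ _ k = ≡.refl
punchIn-punchOut-comm {suc n} {suc i} {suc j} _ _ zero = ≡.refl
punchIn-punchOut-comm {suc n} {suc i} {suc j} i≢j j≢i (suc k) =
  ≡.cong suc (punchIn-punchOut-comm (i≢j ∘ ≡.cong suc) (j≢i ∘ ≡.cong suc) k)

avoid-pair : ∀ {n} (p q : Fin (suc (suc (suc n)))) → Σ (Fin (suc (suc (suc n)))) λ r → r ≢ p × r ≢ q
avoid-pair zero          zero          = suc zero , (λ ()) , (λ ())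
avoid-pair zero          (suc zero)    = suc (suc zero) , (λ ()) , (λ ())
avoid-pair zero          (suc (suc _)) = suc zero , (λ ()) , (λ ())
avoid-pair (suc zero)    zero          = suc (suc zero) , (λ ()) , (λ ())
avoid-pair (suc (suc _)) zero          = suc zero , (λ ()) , (λ ())
avoid-pair (suc _)       (suc _)       = zero , (λ ()) , (λ ())

module Determinant {c ℓ} (D : CompleteDVR c ℓ) (m : ℕ) where
  open CompleteDVR D hiding (zero)
  open Procedure D m
  open import Relation.Binary.Reasoning.Setoid setoid
  open import Algebra.Properties.Ring ring using (-1*x≈-x; -‿distribˡ-*; -‿distribʳ-*)
  open import Algebra.Properties.AbelianGroup +-abelianGroup using (⁻¹-involutive)
  open import Algebra.Properties.Semiring.Sum semiring
    using (sum; sum-cong-≋; ∑-distrib-+; ∑-comm; sum-remove; *-distribˡ-sum)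
  open import Algebra.Solver.CommutativeMonoid *-commutativeMonoid using (solve; _⊜_; _⊕_)

  sumFin≡sum : ∀ {n} (f : Fin n → Carrier) → sumFin f ≡ sum f
  sumFin≡sum {zero}  f = ≡.refl
  sumFin≡sum {suc n} f = ≡.cong (f zero +_) (sumFin≡sum (f ∘ suc))

  sumFin-cong : ∀ {n} {f g : Fin n → Carrier} → (∀ i → f i ≈ g i) → sumFin f ≈ sumFin g
  sumFin-cong {f = f} {g} f≈g rewrite sumFin≡sum f | sumFin≡sum g = sum-cong-≋ f≈g

  sumFin-zero : ∀ {n} {f : Fin n → Carrier} → (∀ i → f i ≈ 0#) → sumFin f ≈ 0#
  sumFin-zero {zero}  _   = refl
  sumFin-zero {suc n} f≈0 = trans (+-cong (f≈0 zero) (sumFin-zero (f≈0 ∘ suc))) (+-identityʳ 0#)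

  sumFin-linear : ∀ {n} {f g h : Fin n → Carrier} x → (∀ i → f i ≈ g i + x * h i) →
                  sumFin f ≈ sumFin g + x * sumFin h
  sumFin-linear {f = f} {g} {h} x f≈g+xh
    rewrite sumFin≡sum f | sumFin≡sum g | sumFin≡sum h = begin
      sum f                         ≈⟨ sum-cong-≋ f≈g+xh ⟩
      sum (λ i → g i + x * h i)     ≈⟨ ∑-distrib-+ g (λ i → x * h i) ⟩
      sum g + sum (λ i → x * h i)   ≈⟨ +-congˡ (sym (*-distribˡ-sum x h)) ⟩
      sum g + x * sum h             ∎

  *-distribˡ-sumFin : ∀ {n} x (f : Fin n → Carrier) → x * sumFin f ≈ sumFin (λ i → x * f i)
  *-distribˡ-sumFin x f rewrite sumFin≡sum f | sumFin≡sum (λ i → x * f i) = *-distribˡ-sum x f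

  *-distribˡ-sumFin₂ : ∀ {n} x y (f : Fin n → Carrier) → x * (y * sumFin f) ≈ sumFin (λ i → x * (y * f i))
  *-distribˡ-sumFin₂ x y f = trans (*-congˡ (*-distribˡ-sumFin y f)) (*-distribˡ-sumFin x (λ i → y * f i))

  sumFin-comm : ∀ {a b} (f : Fin a → Fin b → Carrier) →
                sumFin (λ i → sumFin (f i)) ≈ sumFin (λ j → sumFin (λ i → f i j))
  sumFin-comm f = begin
    sumFin (λ i → sumFin (f i))             ≈⟨ sumFin-cong (λ i → reflexive (sumFin≡sum (f i))) ⟩
    sumFin (λ i → sum (f i))                ≡⟨ sumFin≡sum (λ i → sum (f i)) ⟩
    sum (λ i → sum (f i))                   ≈⟨ ∑-comm f ⟩
    sum (λ j → sum (λ i → f i j))           ≡⟨ sumFin≡sum (λ j → sum (λ i → f i j)) ⟨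
    sumFin (λ j → sum (λ i → f i j))        ≈⟨ sumFin-cong (λ j → reflexive (sumFin≡sum (λ i → f i j))) ⟨
    sumFin (λ j → sumFin (λ i → f i j))     ∎

  sumFin-remove : ∀ {n} (f : Fin (suc n) → Carrier) i → sumFin f ≈ f i + sumFin (f ∘ punchIn i)
  sumFin-remove f i rewrite sumFin≡sum f | sumFin≡sum (f ∘ punchIn i) = sum-remove f

  sumFin-single : ∀ {n} (f : Fin (suc n) → Carrier) i → (∀ k → k ≢ i → f k ≈ 0#) → sumFin f ≈ f i
  sumFin-single f i f≈0 = begin
    sumFin f                         ≈⟨ sumFin-remove f i ⟩
    f i + sumFin (f ∘ punchIn i)     ≈⟨ +-congˡ (sumFin-zero (λ k → f≈0 (punchIn i k) (Fin.punchInᵢ≢i i k))) ⟩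
    f i + 0#                         ≈⟨ +-identityʳ (f i) ⟩
    f i                              ∎

  sgn-+ : ∀ a b → sgn (a ℕ.+ b) ≈ sgn a * sgn b
  sgn-+ zero    b = sym (*-identityˡ (sgn b))
  sgn-+ (suc a) b = trans (-‿cong (sgn-+ a b)) (-‿distribˡ-* (sgn a) (sgn b))

  -x*-y≈x*y : ∀ x y → - x * - y ≈ x * y
  -x*-y≈x*y x y = trans (sym (-‿distribˡ-* x (- y)))
                        (trans (-‿cong (sym (-‿distribʳ-* x y))) (⁻¹-involutive (x * y)))

  sgn-punchIn-punchOut : ∀ {n} (q : Fin (suc n)) (x : Fin n) (l≢q : punchIn q x ≢ q) →
    sgn (toℕ (punchIn q x)) * sgn (toℕ (punchOut l≢q)) ≈ - (sgn (toℕ q) * sgn (toℕ x))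
  sgn-punchIn-punchOut {suc n} zero x _ =
    trans (*-identityʳ _) (-‿cong (sym (*-identityˡ _)))
  sgn-punchIn-punchOut (suc q) zero _ =
    trans (*-identityˡ _) (trans (sym (⁻¹-involutive _)) (-‿cong (sym (*-identityʳ _))))
  sgn-punchIn-punchOut {suc n} (suc q) (suc x) l≢q = begin
    - sgn (toℕ (punchIn q x)) * - sgn (toℕ (punchOut (l≢q ∘ ≡.cong suc)))
      ≈⟨ -x*-y≈x*y _ _ ⟩
    sgn (toℕ (punchIn q x)) * sgn (toℕ (punchOut (l≢q ∘ ≡.cong suc)))
      ≈⟨ sgn-punchIn-punchOut q x (l≢q ∘ ≡.cong suc) ⟩
    - (sgn (toℕ q) * sgn (toℕ x))
      ≈⟨ -‿cong (-x*-y≈x*y _ _) ⟨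
    - (- sgn (toℕ q) * - sgn (toℕ x)) ∎

  _≈ᴹ_ : ∀ {r s} → Matrix r s → Matrix r s → Set ℓ
  M ≈ᴹ N = ∀ k l → M k l ≈ N k l

  _ᵀ : ∀ {r s} → Matrix r s → Matrix s r
  (M ᵀ) k l = M l k

  cofactorTerm : ∀ {n} → Matrix (suc n) (suc n) → Fin (suc n) → Carrier
  cofactorTerm M j = sgn (toℕ j) * (M zero j * det (minor M zero j))

  det-cong : ∀ {n} {M N : Matrix n n} → M ≈ᴹ N → det M ≈ det N
  det-cong {zero}  _   = refl
  det-cong {suc n} M≈N = sumFin-cong λ j →
    *-congˡ {sgn (toℕ j)} (*-cong (M≈N zero j) (det-cong (λ k l → M≈N (punchIn zero k) (punchIn j l))))

  det-linear : ∀ {n} (p : Fin n) x {N X Y : Matrix n n} →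
    (∀ k → k ≢ p → ∀ l → N k l ≈ X k l) → (∀ k → k ≢ p → ∀ l → N k l ≈ Y k l) →
    (∀ l → N p l ≈ X p l + x * Y p l) → det N ≈ det X + x * det Y
  det-linear {suc n} zero x {N} {X} {Y} N≈X N≈Y Np≈ = sumFin-linear x λ j → begin
    sgn (toℕ j) * (N zero j * det (minor N zero j))
      ≈⟨ *-congˡ (*-cong (Np≈ j) (det-cong (λ k l → N≈X (suc k) (λ ()) _))) ⟩
    sgn (toℕ j) * ((X zero j + x * Y zero j) * det (minor X zero j))
      ≈⟨ linearˡ _ _ _ _ _ ⟩
    sgn (toℕ j) * (X zero j * det (minor X zero j)) + x * (sgn (toℕ j) * (Y zero j * det (minor X zero j)))
      ≈⟨ +-congˡ (*-congˡ (*-congˡ (*-congˡ (det-cong (λ k l → trans (sym (N≈X (suc k) (λ ()) _)) (N≈Y (suc k) (λ ()) _)))))) ⟩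
    sgn (toℕ j) * (X zero j * det (minor X zero j)) + x * (sgn (toℕ j) * (Y zero j * det (minor Y zero j))) ∎
    where
    linearˡ : ∀ s a b d y → s * ((a + y * b) * d) ≈ s * (a * d) + y * (s * (b * d))
    linearˡ s a b d y = begin
      s * ((a + y * b) * d)               ≈⟨ *-congˡ (distribʳ d a (y * b)) ⟩
      s * (a * d + (y * b) * d)           ≈⟨ distribˡ s (a * d) ((y * b) * d) ⟩
      s * (a * d) + s * ((y * b) * d)
        ≈⟨ +-congˡ (solve 4 (λ s y b d → s ⊕ ((y ⊕ b) ⊕ d) ⊜ y ⊕ (s ⊕ (b ⊕ d))) refl s y b d) ⟩
      s * (a * d) + y * (s * (b * d))     ∎
  det-linear {suc n} (suc p) x {N} {X} {Y} N≈X N≈Y Np≈ = sumFin-linear x λ j → begin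
    sgn (toℕ j) * (N zero j * det (minor N zero j))
      ≈⟨ *-congˡ (*-congˡ (det-linear p x
           (λ k k≢p l → N≈X (suc k) (k≢p ∘ Fin.suc-injective) _)
           (λ k k≢p l → N≈Y (suc k) (k≢p ∘ Fin.suc-injective) _)
           (λ l → Np≈ (punchIn j l)))) ⟩
    sgn (toℕ j) * (N zero j * (det (minor X zero j) + x * det (minor Y zero j)))
      ≈⟨ linearʳ _ _ _ _ _ ⟩
    sgn (toℕ j) * (N zero j * det (minor X zero j)) + x * (sgn (toℕ j) * (N zero j * det (minor Y zero j)))
      ≈⟨ +-cong (*-congˡ (*-congʳ (N≈X zero (λ ()) j))) (*-congˡ (*-congˡ (*-congʳ (N≈Y zero (λ ()) j)))) ⟩
    sgn (toℕ j) * (X zero j * det (minor X zero j)) + x * (sgn (toℕ j) * (Y zero j * det (minor Y zero j))) ∎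
    where
    linearʳ : ∀ s a d e y → s * (a * (d + y * e)) ≈ s * (a * d) + y * (s * (a * e))
    linearʳ s a d e y = begin
      s * (a * (d + y * e))               ≈⟨ *-congˡ (distribˡ a d (y * e)) ⟩
      s * (a * d + a * (y * e))           ≈⟨ distribˡ s (a * d) (a * (y * e)) ⟩
      s * (a * d) + s * (a * (y * e))
        ≈⟨ +-congˡ (solve 4 (λ s a y e → s ⊕ (a ⊕ (y ⊕ e)) ⊜ y ⊕ (s ⊕ (a ⊕ e))) refl s a y e) ⟩
      s * (a * d) + y * (s * (a * e))     ∎

  det-zeroRow : ∀ {n} (N : Matrix n n) p → (∀ l → N p l ≈ 0#) → det N ≈ 0#
  det-zeroRow N p Np≈0 = begin
    det N                   ≈⟨ det-linear p (- 1#) (λ _ _ _ → refl) (λ _ _ _ → refl)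
                                 (λ l → trans (Np≈0 l) (sym (x+[-1]x≈0 (N p l)))) ⟩
    det N + - 1# * det N    ≈⟨ x+[-1]x≈0 (det N) ⟩
    0#                      ∎
    where
    x+[-1]x≈0 : ∀ x → x + - 1# * x ≈ 0#
    x+[-1]x≈0 x = trans (+-congˡ (-1*x≈-x x)) (-‿inverseʳ x)

  det-pivot : ∀ {n} (N : Matrix (suc n) (suc n)) p q → (∀ l → l ≢ q → N p l ≈ 0#) →
              det N ≈ sgn (toℕ p ℕ.+ toℕ q) * (N p q * det (minor N p q))
  det-pivot N zero q Np≈0 = sumFin-single (cofactorTerm N) q λ l l≢q → begin
    sgn (toℕ l) * (N zero l * det (minor N zero l))   ≈⟨ *-congˡ (*-congʳ (Np≈0 l l≢q)) ⟩
    sgn (toℕ l) * (0# * det (minor N zero l))        ≈⟨ *-congˡ (zeroˡ _) ⟩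
    sgn (toℕ l) * 0#                                  ≈⟨ zeroʳ _ ⟩
    0#                                                ∎
  det-pivot {suc n} N (suc p) q Np≈0 = begin
    det N                                                     ≈⟨ sumFin-remove (cofactorTerm N) q ⟩
    cofactorTerm N q + sumFin (cofactorTerm N ∘ punchIn q)    ≈⟨ +-cong cofactor-q≈0 (sumFin-cong cofactor-punchIn) ⟩
    0# + sumFin (λ x → s * (a * cofactorTerm M′ x))           ≈⟨ +-identityˡ _ ⟩
    sumFin (λ x → s * (a * cofactorTerm M′ x))                ≈⟨ *-distribˡ-sumFin₂ s a (cofactorTerm M′) ⟨
    s * (a * det M′)                                          ∎
    where
    s = sgn (toℕ (Fin.suc p) ℕ.+ toℕ q)
    a = N (suc p) q
    M′ = minor N (suc p) q

    cofactor-q≈0 : cofactorTerm N q ≈ 0#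
    cofactor-q≈0 = trans (*-congˡ (trans (*-congˡ (det-zeroRow (minor N zero q) p
                     (λ x → Np≈0 (punchIn q x) (Fin.punchInᵢ≢i q x)))) (zeroʳ _))) (zeroʳ _)

    cofactor-punchIn : ∀ x → cofactorTerm N (punchIn q x) ≈ s * (a * cofactorTerm M′ x)
    cofactor-punchIn x = begin
      sgn (toℕ l) * (b * det (minor N zero l))
        ≈⟨ *-congˡ (*-congˡ (det-pivot (minor N zero l) p q′ (λ y y≢q′ → Np≈0 (punchIn l y) (y≢q′ ∘ punchIn-injective)))) ⟩
      sgn (toℕ l) * (b * (sgn (toℕ p ℕ.+ toℕ q′) * (N (suc p) (punchIn l q′) * det (minor (minor N zero l) p q′))))
        ≈⟨ *-congˡ (*-congˡ (*-cong (sgn-+ (toℕ p) (toℕ q′))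
                                     (*-cong (reflexive (≡.cong (N (suc p)) (Fin.punchIn-punchOut l≢q)))
                                             (det-cong minors-agree)))) ⟩
      sgn (toℕ l) * (b * ((sgn (toℕ p) * sgn (toℕ q′)) * (a * d)))
        ≈⟨ solve 6 (λ sl b sp sq′ a d → sl ⊕ (b ⊕ ((sp ⊕ sq′) ⊕ (a ⊕ d))) ⊜ (sl ⊕ sq′) ⊕ (sp ⊕ (a ⊕ (b ⊕ d))))
                   refl _ _ _ _ _ _ ⟩
      (sgn (toℕ l) * sgn (toℕ q′)) * (sgn (toℕ p) * (a * (b * d)))
        ≈⟨ *-congʳ (sgn-punchIn-punchOut q x l≢q) ⟩
      - (sgn (toℕ q) * sgn (toℕ x)) * (sgn (toℕ p) * (a * (b * d)))
        ≈⟨ -‿distribˡ-* _ _ ⟨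
      - ((sgn (toℕ q) * sgn (toℕ x)) * (sgn (toℕ p) * (a * (b * d))))
        ≈⟨ -‿cong (solve 6 (λ sq sx sp a b d → (sq ⊕ sx) ⊕ (sp ⊕ (a ⊕ (b ⊕ d))) ⊜ (sp ⊕ sq) ⊕ (a ⊕ (sx ⊕ (b ⊕ d))))
                           refl _ _ _ _ _ _) ⟩
      - ((sgn (toℕ p) * sgn (toℕ q)) * (a * (sgn (toℕ x) * (b * d))))
        ≈⟨ -‿distribˡ-* _ _ ⟩
      - (sgn (toℕ p) * sgn (toℕ q)) * (a * (sgn (toℕ x) * (b * d)))
        ≈⟨ *-congʳ (-‿cong (sgn-+ (toℕ p) (toℕ q))) ⟨
      s * (a * cofactorTerm M′ x) ∎
      where
      l = punchIn q x
      b = N zero l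
      l≢q : l ≢ q
      l≢q = Fin.punchInᵢ≢i q x
      q′ = punchOut l≢q
      d = det (minor M′ zero x)
      punchIn-injective : ∀ {y} → punchIn l y ≡ q → y ≡ q′
      punchIn-injective {y} eq = Fin.punchIn-injective l y q′ (≡.trans eq (≡.sym (Fin.punchIn-punchOut l≢q)))
      minors-agree : minor (minor N zero l) p q′ ≈ᴹ minor M′ zero x
      minors-agree r k = reflexive (≡.cong (N (suc (punchIn p r)))
        (≡.trans (punchIn-punchOut-comm l≢q (l≢q ∘ ≡.sym) k)
                 (≡.cong (λ y → punchIn q (punchIn y k)) (≡.trans (Fin.punchOut-cong q ≡.refl) (Fin.punchOut-punchIn q)))))

  []≔-rowAt : ∀ {r s} (N : Matrix r s) p {x : Fin s → Carrier} l → (N [ p ]≔ x) p l ≈ x l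
  []≔-rowAt N p l = reflexive (≡.cong (λ row → row l) ([]≔-updates N p))

  []≔-rowOff : ∀ {r s} (N : Matrix r s) {p k} {x : Fin s → Carrier} → k ≢ p → ∀ l → (N [ p ]≔ x) k l ≈ N k l
  []≔-rowOff N k≢p l = reflexive (≡.cong (λ row → row l) ([]≔-minimal N k≢p))

  det-sumRow : ∀ {n} k (f : Fin k → Fin n → Carrier) (N : Matrix n n) p →
               (∀ l → N p l ≈ sumFin (λ t → f t l)) → det N ≈ sumFin (λ t → det (N [ p ]≔ f t))
  det-sumRow zero    f N p Np≈ = det-zeroRow N p Np≈
  det-sumRow (suc k) f N p Np≈ = begin
    det N
      ≈⟨ det-linear p 1# {N} {N [ p ]≔ f zero} {Y}
           (λ k k≢p l → sym ([]≔-rowOff N k≢p l)) (λ k k≢p l → sym ([]≔-rowOff N k≢p l))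
           (λ l → trans (Np≈ l) (+-cong (sym ([]≔-rowAt N p l))
                                        (trans (sym (*-identityˡ _)) (*-congˡ (sym ([]≔-rowAt N p l)))))) ⟩
    det (N [ p ]≔ f zero) + 1# * det Y                               ≈⟨ +-congˡ (*-identityˡ _) ⟩
    det (N [ p ]≔ f zero) + det Y                                    ≈⟨ +-congˡ (det-sumRow k (f ∘ suc) Y p ([]≔-rowAt N p)) ⟩
    det (N [ p ]≔ f zero) + sumFin (λ t → det (Y [ p ]≔ f (suc t)))
      ≈⟨ +-congˡ (sumFin-cong λ t → det-cong λ r l →
           reflexive (≡.cong (λ row → row l) (updateAt-updateAt p {const (f (suc t))} {const rest} N r))) ⟩
    sumFin (λ t → det (N [ p ]≔ f t))                                ∎
    where
    rest = λ l → sumFin (λ t → f (suc t) l)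
    Y = N [ p ]≔ rest

  det-expandRow : ∀ {n} (N : Matrix (suc n) (suc n)) p →
                  det N ≈ sumFin (λ l → sgn (toℕ p ℕ.+ toℕ l) * (N p l * det (minor N p l)))
  det-expandRow N p = trans (det-sumRow _ entryRow N p row≈) (sumFin-cong expand-entryRow)
    where
    entryRow : Fin _ → Fin _ → Carrier
    entryRow t = (λ _ → 0#) [ t ]≔ N p t
    row≈ : ∀ l → N p l ≈ sumFin (λ t → entryRow t l)
    row≈ l = sym (trans (sumFin-single (λ t → entryRow t l) l (λ t t≢l → reflexive ([]≔-minimal (λ _ → 0#) (t≢l ∘ ≡.sym))))
                        (reflexive ([]≔-updates (λ _ → 0#) l)))
    expand-entryRow : ∀ t → det (N [ p ]≔ entryRow t) ≈ sgn (toℕ p ℕ.+ toℕ t) * (N p t * det (minor N p t))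
    expand-entryRow t = trans
      (det-pivot (N [ p ]≔ entryRow t) p t (λ l l≢t → trans ([]≔-rowAt N p l) (reflexive ([]≔-minimal (λ _ → 0#) l≢t))))
      (*-congˡ (*-cong (trans ([]≔-rowAt N p t) (reflexive ([]≔-updates (λ _ → 0#) t)))
                       (det-cong (λ r k → []≔-rowOff N (Fin.punchInᵢ≢i p r) (punchIn t k)))))

  det-1×1 : (A : Matrix 1 1) → det A ≈ A zero zero
  det-1×1 A = trans (+-identityʳ _) (trans (*-identityˡ _) (*-identityʳ _))

  det-2×2 : (M : Matrix 2 2) → det M ≈ M zero zero * M (suc zero) (suc zero) - M zero (suc zero) * M (suc zero) zero
  det-2×2 M = +-cong (trans (*-identityˡ _) (*-congˡ (det-1×1 (minor M zero zero))))
                     (trans (+-identityʳ _) (trans (-1*x≈-x _) (-‿cong (*-congˡ (det-1×1 (minor M zero (suc zero)))))))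

  det-2×2-equalRows : (M : Matrix 2 2) → (∀ l → M zero l ≈ M (suc zero) l) → det M ≈ 0#
  det-2×2-equalRows M M0≈M1 = begin
    det M                                   ≈⟨ det-2×2 M ⟩
    a * M (suc zero) (suc zero) - b * M (suc zero) zero
                                            ≈⟨ +-cong (*-congˡ (sym (M0≈M1 (suc zero)))) (-‿cong (*-congˡ (sym (M0≈M1 zero)))) ⟩
    a * b - b * a                           ≈⟨ +-congˡ (-‿cong (*-comm b a)) ⟩
    a * b - a * b                           ≈⟨ -‿inverseʳ (a * b) ⟩
    0#                                      ∎
    where
    a = M zero zero
    b = M zero (suc zero)

  det-equalRows : ∀ {n} (N : Matrix n n) {p q} → p ≢ q → (∀ l → N p l ≈ N q l) → det N ≈ 0#
  det-equalRows {1} N {zero} {zero} p≢q _ = ⊥-elim (p≢q ≡.refl)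
  det-equalRows {2} N {zero} {zero} p≢q _ = ⊥-elim (p≢q ≡.refl)
  det-equalRows {2} N {suc zero} {suc zero} p≢q _ = ⊥-elim (p≢q ≡.refl)
  det-equalRows {2} N {zero} {suc zero} _ N0≈N1 = det-2×2-equalRows N N0≈N1
  det-equalRows {2} N {suc zero} {zero} _ N1≈N0 = det-2×2-equalRows N (sym ∘ N1≈N0)
  det-equalRows {suc (suc (suc n))} N {p} {q} p≢q Np≈Nq = trans (det-expandRow N r) (sumFin-zero λ l →
        trans (*-congˡ {sgn (toℕ r ℕ.+ toℕ l)} (*-congˡ {N r l}
                (det-equalRows (minor N r l) (p≢q ∘ Fin.punchOut-injective r≢p r≢q) (equalMinorRows l))))
              (trans (*-congˡ (zeroʳ _)) (zeroʳ _)))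
    where
    r = proj₁ (avoid-pair p q)
    r≢p = proj₁ (proj₂ (avoid-pair p q))
    r≢q = proj₂ (proj₂ (avoid-pair p q))
    equalMinorRows : ∀ l k → minor N r l (punchOut r≢p) k ≈ minor N r l (punchOut r≢q) k
    equalMinorRows l k = begin
      N (punchIn r (punchOut r≢p)) (punchIn l k) ≡⟨ ≡.cong (λ i → N i (punchIn l k)) (Fin.punchIn-punchOut r≢p) ⟩
      N p (punchIn l k)                          ≈⟨ Np≈Nq (punchIn l k) ⟩
      N q (punchIn l k)                          ≡⟨ ≡.cong (λ i → N i (punchIn l k)) (Fin.punchIn-punchOut r≢q) ⟨
      N (punchIn r (punchOut r≢q)) (punchIn l k) ∎

  det-subtractRowMultiple : ∀ {n} {N N′ : Matrix n n} {i k} x → k ≢ i →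
    (∀ k′ → k′ ≢ k → ∀ l → N′ k′ l ≈ N k′ l) → (∀ l → N′ k l ≈ N k l - x * N i l) → det N′ ≈ det N
  det-subtractRowMultiple {N = N} {N′} {i} {k} x k≢i N′≈N N′k≈ = begin
    det N′                     ≈⟨ det-linear k (- x) {N′} {N} {Nᵢ} N′≈N
                                    (λ k′ k′≢k l → trans (N′≈N k′ k′≢k l) (sym ([]≔-rowOff N k′≢k l)))
                                    (λ l → trans (N′k≈ l) (+-congˡ (trans (-‿distribˡ-* x (N i l))
                                                                          (*-congˡ (sym ([]≔-rowAt N k l)))))) ⟩
    det N + - x * det Nᵢ       ≈⟨ +-congˡ (*-congˡ (det-equalRows Nᵢ k≢i (λ l →
                                    trans ([]≔-rowAt N k l) (sym ([]≔-rowOff N (k≢i ∘ ≡.sym) l))))) ⟩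
    det N + - x * 0#           ≈⟨ +-congˡ (zeroʳ (- x)) ⟩
    det N + 0#                 ≈⟨ +-identityʳ (det N) ⟩
    det N                      ∎
    where
    Nᵢ = N [ k ]≔ N i

  splice : ∀ {n} → ℕ → Matrix n n → Matrix n n → Matrix n n
  splice t N′ N k with toℕ k ℕ.<? t
  ... | yes _ = N′ k
  ... | no _  = N k

  splice-< : ∀ {n} {t} (N′ N : Matrix n n) {k} → toℕ k ℕ.< t → splice t N′ N k ≡ N′ k
  splice-< {t = t} N′ N {k} k<t with toℕ k ℕ.<? t
  ... | yes _  = ≡.refl
  ... | no k≮t = ⊥-elim (k≮t k<t)

  splice-≮ : ∀ {n} {t} (N′ N : Matrix n n) {k} → ¬ toℕ k ℕ.< t → splice t N′ N k ≡ N k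
  splice-≮ {t = t} N′ N {k} k≮t with toℕ k ℕ.<? t
  ... | yes k<t = ⊥-elim (k≮t k<t)
  ... | no _    = ≡.refl

  splice-suc : ∀ {n} {t} (N′ N : Matrix n n) {k} → toℕ k ≢ t → splice (suc t) N′ N k ≡ splice t N′ N k
  splice-suc {t = t} N′ N {k} k≢t with toℕ k ℕ.<? t
  ... | yes k<t = splice-< N′ N (ℕ.m<n⇒m<1+n k<t)
  ... | no k≮t  = splice-≮ N′ N (λ k<1+t → k≮t (ℕ.≤∧≢⇒< (ℕ.m<1+n⇒m≤n k<1+t) k≢t))

  det-rowOps-≈ : ∀ {n} {N N′ : Matrix n n} i (x : Fin n → Carrier) → (∀ l → N′ i l ≈ N i l) →
    (∀ k → k ≢ i → ∀ l → N′ k l ≈ N k l - x k * N i l) → det N′ ≈ det N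
  det-rowOps-≈ {n} {N} {N′} i x N′i≈Ni N′k≈ =
    trans (det-cong (λ k l → reflexive (≡.cong (λ row → row l) (≡.sym (splice-< N′ N (Fin.toℕ<n k))))))
          (det-splice n)
    where
    spliceRow-i : ∀ t l → splice t N′ N i l ≈ N i l
    spliceRow-i t l with toℕ i ℕ.<? t
    ... | yes _ = N′i≈Ni l
    ... | no _  = refl

    det-splice : ∀ t → det (splice t N′ N) ≈ det N
    det-splice zero    = det-cong (λ k l → reflexive (≡.cong (λ row → row l) (splice-≮ N′ N ℕ.n≮0)))
    det-splice (suc t) with t ℕ.<? n
    ... | no t≮n  = trans (det-cong (λ k l → reflexive (≡.cong (λ row → row l)
                      (splice-suc N′ N (λ k≡t → t≮n (≡.subst (ℕ._< n) k≡t (Fin.toℕ<n k)))))))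
                      (det-splice t)
    ... | yes t<n = trans det-spliceStep (det-splice t)
      where
      k₀ = Fin.fromℕ< t<n
      others : ∀ k → k ≢ k₀ → ∀ l → splice (suc t) N′ N k l ≈ splice t N′ N k l
      others k k≢k₀ l = reflexive (≡.cong (λ row → row l) (splice-suc N′ N
        (λ k≡t → k≢k₀ (Fin.toℕ-injective (≡.trans k≡t (≡.sym (Fin.toℕ-fromℕ< t<n)))))))
      new : ∀ l → splice (suc t) N′ N k₀ l ≡ N′ k₀ l
      new l = ≡.cong (λ row → row l) (splice-< N′ N (≡.subst (ℕ._< suc t) (≡.sym (Fin.toℕ-fromℕ< t<n)) (ℕ.n<1+n t)))
      old : ∀ l → splice t N′ N k₀ l ≡ N k₀ l
      old l = ≡.cong (λ row → row l) (splice-≮ N′ N (≡.subst (λ s → ¬ s ℕ.< t) (≡.sym (Fin.toℕ-fromℕ< t<n)) (ℕ.n≮n t)))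
      det-spliceStep : det (splice (suc t) N′ N) ≈ det (splice t N′ N)
      det-spliceStep with k₀ Fin.≟ i
      ... | yes ≡.refl = det-cong λ k l → case k Fin.≟ k₀ of λ where
              (yes ≡.refl) → trans (reflexive (new l)) (trans (N′i≈Ni l) (sym (reflexive (old l))))
              (no k≢k₀)    → others k k≢k₀ l
      ... | no k₀≢i = det-subtractRowMultiple (x k₀) k₀≢i others λ l → begin
              splice (suc t) N′ N k₀ l                       ≡⟨ new l ⟩
              N′ k₀ l                                        ≈⟨ N′k≈ k₀ k₀≢i l ⟩
              N k₀ l - x k₀ * N i l
                ≈⟨ +-cong (reflexive (≡.sym (old l))) (-‿cong (*-congˡ (sym (spliceRow-i t l)))) ⟩
              splice t N′ N k₀ l - x k₀ * splice t N′ N i l  ∎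

  rowOps-pivotRow : ∀ {r s} (M : Matrix r s) i c l → rowOps M i c i l ≈ M i l
  rowOps-pivotRow M i c l with i Fin.≟ i
  ... | yes _   = refl
  ... | no i≢i  = ⊥-elim (i≢i ≡.refl)

  rowOps-otherRow : ∀ {r s} (M : Matrix r s) i c {k} → k ≢ i → ∀ l → rowOps M i c k l ≈ M k l - c k * M i l
  rowOps-otherRow M i c {k} k≢i l with k Fin.≟ i
  ... | yes k≡i = ⊥-elim (k≢i k≡i)
  ... | no _    = refl

  colOps-pivotCol : ∀ {r s} (M : Matrix r s) j d k → colOps M j d k j ≈ M k j
  colOps-pivotCol M j d k with j Fin.≟ j
  ... | yes _  = refl
  ... | no j≢j = ⊥-elim (j≢j ≡.refl)

  colOps-otherCol : ∀ {r s} (M : Matrix r s) j d k {l} → l ≢ j → colOps M j d k l ≈ M k l - d l * M k j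
  colOps-otherCol M j d k {l} l≢j with l Fin.≟ j
  ... | yes l≡j = ⊥-elim (l≢j l≡j)
  ... | no _    = refl

  det-rowOps : ∀ {n} (M : Matrix n n) i c → det (rowOps M i c) ≈ det M
  det-rowOps M i c = det-rowOps-≈ i c (rowOps-pivotRow M i c) (λ k k≢i → rowOps-otherRow M i c k≢i)

  det-expandCol₀ : ∀ {n} (M : Matrix (suc n) (suc n)) →
                   det M ≈ sumFin (λ k → sgn (toℕ k) * (M k zero * det (minor M k zero)))
  det-expandCol₀ {zero}  M = refl
  det-expandCol₀ {suc n} M = +-congˡ (begin
    sumFin (λ l → - sgn (toℕ l) * (M zero (suc l) * det (minor M zero (suc l))))
      ≈⟨ sumFin-cong (λ l → *-congˡ { - sgn (toℕ l)} (*-congˡ {M zero (suc l)} (det-expandCol₀ (minor M zero (suc l))))) ⟩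
    sumFin (λ l → - sgn (toℕ l) * (M zero (suc l) * sumFin (λ k → sgn (toℕ k) * (M (suc k) zero * det (M₂ k l)))))
      ≈⟨ sumFin-cong (λ l → *-distribˡ-sumFin₂ (- sgn (toℕ l)) (M zero (suc l))
                                                (λ k → sgn (toℕ k) * (M (suc k) zero * det (M₂ k l)))) ⟩
    sumFin (λ l → sumFin (λ k → term l k))
      ≈⟨ sumFin-comm term ⟩
    sumFin (λ k → sumFin (λ l → term l k))
      ≈⟨ sumFin-cong (λ k → sumFin-cong (λ l →
           swap-factors (sgn (toℕ l)) (M zero (suc l)) (sgn (toℕ k)) (M (suc k) zero) (det (M₂ k l)))) ⟩
    sumFin (λ k → sumFin (λ l → - sgn (toℕ k) * (M (suc k) zero * (sgn (toℕ l) * (M zero (suc l) * det (M₂ k l))))))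
      ≈⟨ sumFin-cong (λ k → *-distribˡ-sumFin₂ (- sgn (toℕ k)) (M (suc k) zero)
                                                (λ l → sgn (toℕ l) * (M zero (suc l) * det (M₂ k l)))) ⟨
    sumFin (λ k → - sgn (toℕ k) * (M (suc k) zero * det (minor M (suc k) zero))) ∎)
    where
    M₂ : Fin (suc n) → Fin (suc n) → Matrix n n
    M₂ k l = minor (minor M zero (suc l)) k zero
    term : Fin (suc n) → Fin (suc n) → Carrier
    term l k = - sgn (toℕ l) * (M zero (suc l) * (sgn (toℕ k) * (M (suc k) zero * det (M₂ k l))))
    swap-factors : ∀ s a t b x → - s * (a * (t * (b * x))) ≈ - t * (b * (s * (a * x)))
    swap-factors s a t b x = begin
      - s * (a * (t * (b * x)))    ≈⟨ -‿distribˡ-* s _ ⟨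
      - (s * (a * (t * (b * x))))  ≈⟨ -‿cong (solve 5 (λ s a t b x → s ⊕ (a ⊕ (t ⊕ (b ⊕ x))) ⊜ t ⊕ (b ⊕ (s ⊕ (a ⊕ x))))
                                                      refl s a t b x) ⟩
      - (t * (b * (s * (a * x))))  ≈⟨ -‿distribˡ-* t _ ⟩
      - t * (b * (s * (a * x)))    ∎

  det-ᵀ : ∀ {n} (M : Matrix n n) → det (M ᵀ) ≈ det M
  det-ᵀ {zero}  M = refl
  det-ᵀ {suc n} M = trans (sumFin-cong (λ j → *-congˡ {sgn (toℕ j)} (*-congˡ {M j zero} (det-ᵀ (minor M j zero)))))
                          (sym (det-expandCol₀ M))

  det-colOps : ∀ {n} (M : Matrix n n) j d → det (colOps M j d) ≈ det M
  det-colOps M j d = trans (det-ᵀ (rowOps (M ᵀ) j d)) (trans (det-rowOps (M ᵀ) j d) (det-ᵀ M))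

  det-expandCol : ∀ {n} (N : Matrix (suc n) (suc n)) q →
                  det N ≈ sumFin (λ k → sgn (toℕ q ℕ.+ toℕ k) * (N k q * det (minor N k q)))
  det-expandCol N q = trans (sym (det-ᵀ N)) (trans (det-expandRow (N ᵀ) q)
    (sumFin-cong (λ k → *-congˡ {sgn (toℕ q ℕ.+ toℕ k)} (*-congˡ {N k q} (det-ᵀ (minor N k q))))))

  unitVec : ∀ {n} → Fin n → Fin n → Carrier
  unitVec q = (λ _ → 0#) [ q ]≔ 1#

  det-addToEntry : ∀ {n} (Y : Matrix (suc n) (suc n)) r q x →
    det (Y [ r ]≔ (λ l → Y r l + x * unitVec q l)) ≈ det Y + x * (sgn (toℕ r ℕ.+ toℕ q) * det (minor Y r q))
  det-addToEntry Y r q x = begin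
    det (Y [ r ]≔ (λ l → Y r l + x * unitVec q l))
      ≈⟨ det-linear r x {Y [ r ]≔ _} {Y} {Z} (λ k k≢r l → []≔-rowOff Y k≢r l)
           (λ k k≢r l → trans ([]≔-rowOff Y k≢r l) (sym ([]≔-rowOff Y k≢r l)))
           (λ l → trans ([]≔-rowAt Y r l) (+-congˡ (*-congˡ (sym ([]≔-rowAt Y r l))))) ⟩
    det Y + x * det Z
      ≈⟨ +-congˡ (*-congˡ (det-pivot Z r q (λ l l≢q → trans ([]≔-rowAt Y r l) (reflexive ([]≔-minimal (λ _ → 0#) l≢q))))) ⟩
    det Y + x * (sgn (toℕ r ℕ.+ toℕ q) * (Z r q * det (minor Z r q)))
      ≈⟨ +-congˡ (*-congˡ (*-congˡ (*-cong (trans ([]≔-rowAt Y r q) (reflexive ([]≔-updates (λ _ → 0#) q)))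
                                            (det-cong (λ k l → []≔-rowOff Y (Fin.punchInᵢ≢i r k) (punchIn q l)))))) ⟩
    det Y + x * (sgn (toℕ r ℕ.+ toℕ q) * (1# * det (minor Y r q)))
      ≈⟨ +-congˡ (*-congˡ (*-congˡ (*-identityˡ _))) ⟩
    det Y + x * (sgn (toℕ r ℕ.+ toℕ q) * det (minor Y r q)) ∎
    where
    Z = Y [ r ]≔ unitVec q

module Congruence {c ℓ} (D : CompleteDVR c ℓ) (m : ℕ) where
  open CompleteDVR D hiding (zero)
  open Procedure D m
  open Valuation D
  open AbelianGroupLemmas +-abelianGroup
  open import Algebra.Properties.Ring ring using (x[y-z]≈xy-xz; -‿distribˡ-*)
  open import Algebra.Properties.AbelianGroup +-abelianGroup using (⁻¹-anti-homo‿-; x≈y⇒x∙y⁻¹≈ε)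

  v-sgn : ∀ e x → v (sgn e * x) ≡ v x
  v-sgn zero    x = v-cong (*-identityˡ x)
  v-sgn (suc e) x = ≡.trans (v-cong (sym (-‿distribˡ-* (sgn e) x))) (≡.trans (v-neg (sgn e * x)) (v-sgn e x))

  v-sgn-≥ : ∀ {b} e {x} → b ≤∞ v x → b ≤∞ v (sgn e * x)
  v-sgn-≥ e {x} b≤vx = ≤∞-trans b≤vx (≤∞-reflexive (≡.sym (v-sgn e x)))

  v-sumFin-≥ : ∀ {n b} (f : Fin n → Carrier) → (∀ i → b ≤∞ v (f i)) → b ≤∞ v (sumFin f)
  v-sumFin-≥ {zero}  f _      = v-0#-≥ _
  v-sumFin-≥ {suc n} f b≤vf  = v-+-≥ (b≤vf zero) (v-sumFin-≥ (f ∘ suc) (b≤vf ∘ suc))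

  v-signedProd : ∀ {n} (a : Vec Carrier n) es → sum∞ (λ h → v (lookup a h)) ≤∞ v (signedProd a es)
  v-signedProd []       []       = 0≤∞ (v 1#)
  v-signedProd (x ∷ a) (e ∷ es) = v-*-mono (≤∞-reflexive (≡.trans (≡.sym (v-sgn e x)) (v-cong (*-comm (sgn e) x))))
                                           (v-signedProd a es)

  ≈⇒≡m : ∀ {x y} → x ≈ y → x ≡m y
  ≈⇒≡m x≈y = v-resp-≈ (sym (x≈y⇒x∙y⁻¹≈ε x≈y)) (v-0#-≥ (fin m))

  ≡m-refl : ∀ x → x ≡m x
  ≡m-refl x = ≈⇒≡m refl

  ≡m-sym : ∀ {x y} → x ≡m y → y ≡m x
  ≡m-sym {x} {y} x≡y = ≤∞-trans x≡y (≤∞-reflexive (≡.trans (≡.sym (v-neg (x - y))) (v-cong (⁻¹-anti-homo‿- x y))))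

  ≡m-trans : ∀ {x y z} → x ≡m y → y ≡m z → x ≡m z
  ≡m-trans {x} {y} {z} x≡y y≡z = v-resp-≈ ([x-y]∙[y-z]≈x-z x y z) (v-+-≥ x≡y y≡z)

  ≡m-− : ∀ {x x′ y y′} → x ≡m x′ → y ≡m y′ → (x - y) ≡m (x′ - y′)
  ≡m-− {x} {x′} {y} {y′} x≡x′ y≡y′ = v-resp-≈ (sym ([x-y]-[u-w]≈[x-u]-[y-w] x y x′ y′)) (v-−-≥ x≡x′ y≡y′)

  ≡m-*ˡ : ∀ z {x y} → x ≡m y → (z * x) ≡m (z * y)
  ≡m-*ˡ z {x} {y} x≡y = v-resp-≈ (x[y-z]≈xy-xz z x y) (≤∞-trans x≡y (v-*ʳ z (x - y)))

  ≡m-+-small : ∀ x {y} → IsZeroMod y → (x + y) ≡m x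
  ≡m-+-small x {y} y≡0 = v-resp-≈ (sym ([x∙y]-x≈y x y)) y≡0

  ≡m-v-≥ : ∀ {b x y} → x ≡m y → b ≤∞ v y → b ≤∞ fin m → b ≤∞ v x
  ≡m-v-≥ {x = x} {y} x≡y b≤vy b≤m = v-resp-≈ (y∙[x-y]≈x x y) (v-+-≥ b≤vy (≤∞-trans b≤m x≡y))

  _≡ᴹ_ : ∀ {r s} → Matrix r s → Matrix r s → Set
  X ≡ᴹ N = ∀ k l → X k l ≡m N k l

  rowOps-≡ᴹ : ∀ {r s} {X N : Matrix r s} i c → X ≡ᴹ N → rowOps X i c ≡ᴹ rowOps N i c
  rowOps-≡ᴹ i c X≡N k l with k Fin.≟ i
  ... | yes _ = X≡N k l
  ... | no _  = ≡m-− (X≡N k l) (≡m-*ˡ (c k) (X≡N i l))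

  colOps-≡ᴹ : ∀ {r s} {X N : Matrix r s} j d → X ≡ᴹ N → colOps X j d ≡ᴹ colOps N j d
  colOps-≡ᴹ j d X≡N k l with l Fin.≟ j
  ... | yes _ = X≡N k l
  ... | no _  = ≡m-− (X≡N k l) (≡m-*ˡ (d l) (X≡N k j))

  ≡ᴹ-refl : ∀ {r s} (X : Matrix r s) → X ≡ᴹ X
  ≡ᴹ-refl X k l = ≡m-refl (X k l)

  minor-≡ᴹ : ∀ {r s} {X N : Matrix (suc r) (suc s)} i j → X ≡ᴹ N → minor X i j ≡ᴹ minor N i j
  minor-≡ᴹ i j X≡N k l = X≡N (punchIn i k) (punchIn j l)

module Reduction {c ℓ} (D : CompleteDVR c ℓ) (m : ℕ) where
  open CompleteDVR D hiding (zero)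
  open Procedure D m
  open Valuation D
  open Determinant D m
  open Congruence D m
  open AbelianGroupLemmas +-abelianGroup
  open import Relation.Binary.Reasoning.Setoid setoid
  open import Algebra.Properties.Ring ring using (x[y-z]≈xy-xz; [y-z]x≈yx-zx)
  open import Algebra.Properties.Semiring.Exp semiring using (_^_)
  open import Algebra.Solver.CommutativeMonoid *-commutativeMonoid using (solve; _⊜_; _⊕_)

  LiftBound : ∀ {n} → Matrix n n → ℕ∞ → Carrier → Set c
  LiftBound N T Π = ∀ Y → Y ≡ᴹ N → T ≤∞ v (det Y - Π)

  liftBound⇒minorBound : ∀ {n} {N : Matrix (suc n) (suc n)} {T Π} → LiftBound N T Π →
    ∀ {Y} → Y ≡ᴹ N → ∀ r q → T ≤∞ (fin m +∞ v (det (minor Y r q)))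
  liftBound⇒minorBound {N = N} {T} {Π} bound {Y} Y≡N r q =
    ≤∞-trans (v-resp-≈ det-difference (v-−-≥ (bound Y′ Y′≡N) (bound Y Y≡N)))
             (≤∞-reflexive (≡.trans (v-mul ε _) (≡.cong₂ _+∞_ (v-π^ m) (v-sgn (toℕ r ℕ.+ toℕ q) _))))
    where
    ε = π ^ m
    Y′ = Y [ r ]≔ (λ l → Y r l + ε * unitVec q l)
    Y′≡N : Y′ ≡ᴹ N
    Y′≡N k l with k Fin.≟ r
    ... | yes ≡.refl = ≡.subst (_≡m N k l) (≡.sym (≡.cong (λ row → row l) ([]≔-updates Y k)))
                         (≡m-trans (≡m-+-small (Y k l) ε*e≡0) (Y≡N k l))
      where
      ε*e≡0 : IsZeroMod (ε * unitVec q l)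
      ε*e≡0 = ≤∞-trans (≤∞-reflexive (≡.sym (v-π^ m))) (v-*ˡ ε (unitVec q l))
    ... | no k≢r    = ≡.subst (_≡m N k l) (≡.sym (≡.cong (λ row → row l) ([]≔-minimal Y k≢r))) (Y≡N k l)

    det-difference : (det Y′ - Π) - (det Y - Π) ≈ ε * (sgn (toℕ r ℕ.+ toℕ q) * det (minor Y r q))
    det-difference = begin
      (det Y′ - Π) - (det Y - Π)   ≈⟨ [x-z]-[y-z]≈x-y (det Y′) (det Y) Π ⟩
      det Y′ - det Y               ≈⟨ +-congʳ (det-addToEntry Y r q ε) ⟩
      (det Y + _) - det Y          ≈⟨ [x∙y]-x≈y (det Y) _ ⟩
      ε * (sgn (toℕ r ℕ.+ toℕ q) * det (minor Y r q)) ∎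

  v-det-smallColumn : ∀ {n} (Q : Matrix (suc n) (suc n)) q {T} → (∀ k → IsZeroMod (Q k q)) →
    (∀ k → T ≤∞ (fin m +∞ v (det (minor Q k q)))) → T ≤∞ v (det Q)
  v-det-smallColumn Q q Qq≡0 T≤ = v-resp-≈ (sym (det-expandCol Q q)) (v-sumFin-≥ _ λ k →
    v-sgn-≥ (toℕ q ℕ.+ toℕ k) (≤∞-trans (T≤ k) (v-*-mono (Qq≡0 k) ≤∞-refl)))

  v-det-besidePivot : ∀ {n} {NB : Matrix (suc n) (suc n)} {i j T Π} → LiftBound (minor NB i j) T Π →
    (∀ k → k ≢ i → IsZeroMod (NB k j)) → ∀ {B} → B ≡ᴹ NB → ∀ l → l ≢ j → T ≤∞ v (det (minor B i l))
  v-det-besidePivot {zero} {j = zero} _ _ _ zero l≢j = ⊥-elim (l≢j ≡.refl)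
  v-det-besidePivot {suc n} {NB = NB} {i} {j} {T} bound col≡0 {B} B≡NB l l≢j =
    v-det-smallColumn (minor B i l) (punchOut l≢j) columnEntry minorsBound
    where
    columnEntry : ∀ k → IsZeroMod (B (punchIn i k) (punchIn l (punchOut l≢j)))
    columnEntry k = ≡.subst (λ col → IsZeroMod (B (punchIn i k) col)) (≡.sym (Fin.punchIn-punchOut l≢j))
                      (≡m-v-≥ (B≡NB (punchIn i k) j) (col≡0 (punchIn i k) (Fin.punchInᵢ≢i i k)) ≤∞-refl)
    minorsBound : ∀ k → T ≤∞ (fin m +∞ v (det (minor (minor B i l) k (punchOut l≢j))))
    minorsBound k = ≤∞-trans (liftBound⇒minorBound bound (minor-≡ᴹ i j B≡NB) k (punchOut (l≢j ∘ ≡.sym)))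
      (≤∞-reflexive (≡.cong (fin m +∞_) (v-cong (det-cong λ r s →
        reflexive (≡.cong (B (punchIn i (punchIn k r))) (punchIn-punchOut-comm (l≢j ∘ ≡.sym) l≢j s))))))

  v-det-pivotBlock : ∀ {n} {NB : Matrix (suc n) (suc n)} {i j T Π} → LiftBound (minor NB i j) T Π →
    (∀ k → k ≢ i → IsZeroMod (NB k j)) → (∀ l → l ≢ j → IsZeroMod (NB i l)) →
    ∀ {B} → B ≡ᴹ NB → (fin m +∞ T) ≤∞ v (det B - sgn (toℕ i ℕ.+ toℕ j) * (B i j * det (minor B i j)))
  v-det-pivotBlock {i = i} {j} bound col≡0 row≡0 {B} B≡NB =
    v-resp-≈ (sym remainder) (v-sumFin-≥ (term ∘ punchIn j) λ x →
      v-sgn-≥ (toℕ i ℕ.+ toℕ (punchIn j x)) (v-*-mono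
        (≡m-v-≥ (B≡NB i (punchIn j x)) (row≡0 (punchIn j x) (Fin.punchInᵢ≢i j x)) ≤∞-refl)
        (v-det-besidePivot bound col≡0 B≡NB (punchIn j x) (Fin.punchInᵢ≢i j x))))
    where
    term : Fin _ → Carrier
    term l = sgn (toℕ i ℕ.+ toℕ l) * (B i l * det (minor B i l))

    remainder : det B - term j ≈ sumFin (term ∘ punchIn j)
    remainder = trans (+-congʳ (trans (det-expandRow B i) (sumFin-remove term j))) ([x∙y]-x≈y (term j) _)

  errorBound : ∀ {n} → Vec Carrier n → ℕ∞
  errorBound a = min∞Fin (λ h → m ∸∞ v (lookup a h)) +∞ sum∞ (λ h → v (lookup a h))

  module _ {n} (a₁ : Carrier) (a : Vec Carrier n) {k} (va₁≡k : v a₁ ≡ fin k) where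
    private
      μ = min∞Fin (λ h → m ∸∞ v (lookup a h))
      σ = sum∞ (λ h → v (lookup a h))

      errorBound-cons : errorBound (a₁ ∷ a) ≡ (min∞ (fin (m ℕ.∸ k)) μ +∞ (fin k +∞ σ))
      errorBound-cons rewrite va₁≡k = ≡.refl

    errorBound-≤-pivotTerm : errorBound (a₁ ∷ a) ≤∞ (fin k +∞ errorBound a)
    errorBound-≤-pivotTerm rewrite errorBound-cons =
      ≤∞-trans (+∞-mono-≤∞ (min∞-≤ʳ (fin (m ℕ.∸ k)) μ) ≤∞-refl)
               (≤∞-reflexive (≡.trans (≡.sym (+∞-assoc μ (fin k) σ))
                             (≡.trans (≡.cong (_+∞ σ) (+∞-comm μ (fin k))) (+∞-assoc (fin k) μ σ))))

    errorBound-≤-liftTerm : k ≤ m → errorBound (a₁ ∷ a) ≤∞ (fin m +∞ sum∞ (λ h → v (lookup a h)))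
    errorBound-≤-liftTerm k≤m rewrite errorBound-cons =
      ≤∞-trans (+∞-mono-≤∞ (min∞-≤ˡ (fin (m ℕ.∸ k)) μ) ≤∞-refl)
               (≤∞-reflexive (≡.trans (≡.sym (+∞-assoc (fin (m ℕ.∸ k)) (fin k) σ))
                                      (≡.cong (λ z → fin z +∞ σ) (ℕ.m∸n+n≡m k≤m))))

    errorBound-≤-remainder : k ≤ m → errorBound (a₁ ∷ a) ≤∞ (fin m +∞ errorBound a)
    errorBound-≤-remainder k≤m = ≤∞-trans errorBound-≤-pivotTerm (+∞-mono-≤∞ (fin≤fin k≤m) ≤∞-refl)

  error-split : ∀ Δ s β M a₁ Π →
    Δ - (a₁ * s) * Π ≈ ((Δ - s * (β * M)) + s * (β * (M - Π))) + s * ((β - a₁) * Π)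
  error-split Δ s β M a₁ Π = sym (begin
    ((Δ - s * (β * M)) + s * (β * (M - Π))) + s * ((β - a₁) * Π)
      ≈⟨ +-cong (+-congˡ (trans (*-congˡ (x[y-z]≈xy-xz β M Π)) (x[y-z]≈xy-xz s _ _)))
                (trans (*-congˡ ([y-z]x≈yx-zx Π β a₁)) (x[y-z]≈xy-xz s _ _)) ⟩
    ((Δ - s * (β * M)) + (s * (β * M) - s * (β * Π))) + (s * (β * Π) - s * (a₁ * Π))
      ≈⟨ +-congʳ ([x-y]∙[y-z]≈x-z Δ _ _) ⟩
    (Δ - s * (β * Π)) + (s * (β * Π) - s * (a₁ * Π))
      ≈⟨ [x-y]∙[y-z]≈x-z Δ _ _ ⟩
    Δ - s * (a₁ * Π)
      ≈⟨ +-congˡ (-‿cong (solve 3 (λ s a₁ Π → s ⊕ (a₁ ⊕ Π) ⊜ (a₁ ⊕ s) ⊕ Π) refl s a₁ Π)) ⟩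
    Δ - (a₁ * s) * Π ∎)

  liftBound-step : ∀ {n} {N : Matrix (suc n) (suc n)} {i j c d a₁} {a : Vec Carrier n} {es} →
    ¬ IsZeroMod (N i j) → a₁ ≡m N i j →
    (∀ k → k ≢ i → (c k * N i j) ≡m N k j) →
    (∀ l → l ≢ j → (d l * rowOps N i c i j) ≡m rowOps N i c i l) →
    LiftBound (minor (colOps (rowOps N i c) j d) i j) (errorBound a) (signedProd a es) →
    LiftBound N (errorBound (a₁ ∷ a)) (signedProd (a₁ ∷ a) (toℕ i ℕ.+ toℕ j ∷ es))
  liftBound-step {N = N} {i} {j} {c} {d} {a₁} {a} {es} Nij≢0 a₁≡Nij c-clears d-clears bound X X≡N
    with fin≰∞⇒fin< (v a₁) (λ a₁≡0 → Nij≢0 (≡m-v-≥ (≡m-sym a₁≡Nij) a₁≡0 ≤∞-refl))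
  ... | k , va₁≡k , k<m =
    v-resp-≈ (sym split) (v-+-≥ (v-+-≥ remainderBound pivotTermBound) liftTermBound)
    where
    k≤m = ℕ.<⇒≤ k<m
    s = sgn (toℕ i ℕ.+ toℕ j)
    Π = signedProd a es
    NB = colOps (rowOps N i c) j d
    B = colOps (rowOps X i c) j d
    B≡NB : B ≡ᴹ NB
    B≡NB = colOps-≡ᴹ j d (rowOps-≡ᴹ i c X≡N)
    β = B i j

    β≡a₁ : β ≡m a₁
    β≡a₁ = ≡m-trans (≈⇒≡m (trans (colOps-pivotCol (rowOps X i c) j d i) (rowOps-pivotRow X i c j)))
                    (≡m-trans (X≡N i j) (≡m-sym a₁≡Nij))

    split : det X - (a₁ * s) * Π ≈
            ((det B - s * (β * det (minor B i j))) + s * (β * (det (minor B i j) - Π))) + s * ((β - a₁) * Π)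
    split = trans (+-congʳ (sym (trans (det-colOps (rowOps X i c) j d) (det-rowOps X i c))))
                  (error-split (det B) s β (det (minor B i j)) a₁ Π)

    pivotColumn≡0 : ∀ k → k ≢ i → IsZeroMod (NB k j)
    pivotColumn≡0 k k≢i = v-resp-≈ (sym (trans (colOps-pivotCol (rowOps N i c) j d k) (rowOps-otherRow N i c k≢i j)))
                            (≡m-sym (c-clears k k≢i))

    pivotRow≡0 : ∀ l → l ≢ j → IsZeroMod (NB i l)
    pivotRow≡0 l l≢j = v-resp-≈ (sym (colOps-otherCol (rowOps N i c) j d i l≢j)) (≡m-sym (d-clears l l≢j))

    remainderBound : errorBound (a₁ ∷ a) ≤∞ v (det B - s * (β * det (minor B i j)))
    remainderBound = ≤∞-trans (errorBound-≤-remainder a₁ a va₁≡k k≤m)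
                              (v-det-pivotBlock bound pivotColumn≡0 pivotRow≡0 B≡NB)

    pivotTermBound : errorBound (a₁ ∷ a) ≤∞ v (s * (β * (det (minor B i j) - Π)))
    pivotTermBound = ≤∞-trans (errorBound-≤-pivotTerm a₁ a va₁≡k) (v-sgn-≥ (toℕ i ℕ.+ toℕ j)
      (v-*-mono (≡m-v-≥ β≡a₁ (≤∞-reflexive (≡.sym va₁≡k)) (fin≤fin k≤m)) (bound (minor B i j) (minor-≡ᴹ i j B≡NB))))

    liftTermBound : errorBound (a₁ ∷ a) ≤∞ v (s * ((β - a₁) * Π))
    liftTermBound = ≤∞-trans (errorBound-≤-liftTerm a₁ a va₁≡k k≤m)
                             (v-sgn-≥ (toℕ i ℕ.+ toℕ j) (v-*-mono β≡a₁ (v-signedProd a es)))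

  liftBound-run : ∀ {n} {N : Matrix n n} {abar es} → Run N n abar es 0 →
    ∀ a → (∀ h → lookup a h ≡m lookup abar h) → LiftBound N (errorBound a) (signedProd a es)
  liftBound-run (stop _) [] _ X _ = v-resp-≈ (sym (-‿inverseʳ 1#)) (v-0#-≥ _)
  liftBound-run (step i j Nij≢0 _ c c-clears d d-clears run) (a₁ ∷ a) lifts =
    liftBound-step {a = a} Nij≢0 (lifts zero) c-clears d-clears (liftBound-run run a (lifts ∘ suc))

proposition1p6p3 : ∀ {c ℓ} (D : CompleteDVR c ℓ) (m : ℕ) → 1 ≤ m →
    let open CompleteDVR D
        open Procedure D m
    in (n : ℕ) (A : Matrix n n) (abar : Vec Carrier n) (es : Vec ℕ n) →
       Run A n abar es 0 →
       (a : Vec Carrier n) → (∀ h → lookup a h ≡m lookup abar h) →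
       (min∞Fin (λ h → m ∸∞ v (lookup a h)) +∞ sum∞ (λ h → v (lookup a h)))
         ≤∞ v (det A - signedProd a es)
proposition1p6p3 D m _ n A abar es run a lifts =
  liftBound-run run a lifts A (≡ᴹ-refl A)
  where open Reduction D m
        open Congruence D m
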